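{- Not every strictly affine $\lambda$-algebra is a strictly affine combinatory $\lambda$-model.
   Context: A strictly affine combinatory algebra (SACA) is an applicative structure $(A,\cdot)$ (application written by juxtaposition, associating to the left) with distinguished elements $B,C,I,K$ such that for all $x,y,z\in A$: $Bxyz=x(yz)$, $Ix=x$, $Cxyz=(xz)y$, $Kxy=x$. $\mathcal T(\mathcal A)$ is the set of terms built from variables, the constants $B,C,I,K$ and a constant $c_a$ for each $a\in A$, closed under application; $[\![\cdot]\!]_{\mathcal A}$ is the natural interpretation of closed terms of $\mathcal T(\mathcal A)$ in $\mathcal A$. The strictly affine $\lambda$-calculus: terms built from variables and constants by application and abstraction $\lambda x.M$ allowed only when $x$ occurs free in $M$ at most once; $=_{\lambda^A}$ is the provable equality generated by $(\lambda x.M)N=M[N/x]$, the rule "from $M=N$ with $x$ free at most once in $M$ and $N$ infer $\lambda x.M=\lambda x.N$", and congruence rules. $(\cdot)_{\lambda^A}$ translates terms of $\mathcal T(\mathcal A)$ into $\lambda$-terms by replacing $B,C,I,K$ with $\lambda xyz.x(yz)$, $\lambda xyz.(xz)y$, $\lambda x.x$, $\lambda xy.x$ respectively. A SACA is a strictly affine $\lambda$-algebra if for all closed $M,N\in\mathcal T(\mathcal A)$, $(M)_{\lambda^A}=_{\lambda^A}(N)_{\lambda^A}$ implies $[\![M]\!]_{\mathcal A}=[\![N]\!]_{\mathcal A}$. A SACA is a strictly affine combinatory $\lambda$-model if there is $\epsilon\in A$ such that for all $x,y\in A$: $\epsilon xy=xy$, and $(\forall z\in A.\ xz=yz)$ implies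 $\epsilon x=\epsilon y$. -}

module Defs where

open import Data.Nat using (ℕ; zero; suc; _+_; _≤_)
open import Data.Fin using (Fin; zero; suc; _≟_)
open import Data.Product using (Σ; _×_; _,_)
open import Relation.Binary.Structures using (IsEquivalence)
open import Relation.Nullary using (¬_; yes; no)

infixl 7 _·_

record SACA : Set₁ where
  infixl 7 _∙_
  infix 4 _≈_
  field
    Carrier       : Set
    _≈_           : Carrier → Carrier → Set
    isEquivalence : IsEquivalence _≈_
    _∙_           : Carrier → Carrier → Carrier
    ∙-cong        : ∀ {x x′ y y′} → x ≈ x′ → y ≈ y′ → x ∙ y ≈ x′ ∙ y′
    B C I K       : Carrier
    B-eq          : ∀ x y z → B ∙ x ∙ y ∙ z ≈ x ∙ (y ∙ z)
    I-eq          : ∀ x → I ∙ x ≈ x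
    C-eq          : ∀ x y z → C ∙ x ∙ y ∙ z ≈ (x ∙ z) ∙ y
    K-eq          : ∀ x y → K ∙ x ∙ y ≈ x

data CTerm (A : Set) : Set where
  `B `C `I `K : CTerm A
  c_          : A → CTerm A
  _·_         : CTerm A → CTerm A → CTerm A

module _ (𝒜 : SACA) where
  open SACA 𝒜

  ⟦_⟧ : CTerm Carrier → Carrier
  ⟦ `B ⟧    = B
  ⟦ `C ⟧    = C
  ⟦ `I ⟧    = I
  ⟦ `K ⟧    = K
  ⟦ c a ⟧   = a
  ⟦ M · N ⟧ = ⟦ M ⟧ ∙ ⟦ N ⟧

data Λ (A : Set) : ℕ → Set where
  var  : ∀ {n} → Fin n → Λ A n
  con  : ∀ {n} → A → Λ A n
  app  : ∀ {n} → Λ A n → Λ A n → Λ A n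
  lam  : ∀ {n} → Λ A (suc n) → Λ A n

module _ {A : Set} where

  occ : ∀ {n} → Fin n → Λ A n → ℕ
  occ i (var j) with i ≟ j
  ... | yes _ = 1
  ... | no _  = 0
  occ i (con _)   = 0
  occ i (app M N) = occ i M + occ i N
  occ i (lam M)   = occ (suc i) M

  data Affine : ∀ {n} → Λ A n → Set where
    var : ∀ {n} (i : Fin n) → Affine (var i)
    con : ∀ {n} (a : A) → Affine {n} (con a)
    app : ∀ {n} {M N : Λ A n} → Affine M → Affine N → Affine (app M N)
    lam : ∀ {n} {M : Λ A (suc n)} → Affine M → occ zero M ≤ 1 → Affine (lam M)

  ext : ∀ {m n} → (Fin m → Fin n) → Fin (suc m) → Fin (suc n)
  ext ρ zero    = zero
  ext ρ (suc i) = suc (ρ i)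

  rename : ∀ {m n} → (Fin m → Fin n) → Λ A m → Λ A n
  rename ρ (var i)   = var (ρ i)
  rename ρ (con a)   = con a
  rename ρ (app M N) = app (rename ρ M) (rename ρ N)
  rename ρ (lam M)   = lam (rename (ext ρ) M)

  exts : ∀ {m n} → (Fin m → Λ A n) → Fin (suc m) → Λ A (suc n)
  exts σ zero    = var zero
  exts σ (suc i) = rename suc (σ i)

  subst : ∀ {m n} → (Fin m → Λ A n) → Λ A m → Λ A n
  subst σ (var i)   = σ i
  subst σ (con a)   = con a
  subst σ (app M N) = app (subst σ M) (subst σ N)
  subst σ (lam M)   = lam (subst (exts σ) M)

  subst₀ : ∀ {n} → Λ A n → Fin (suc n) → Λ A n
  subst₀ N zero    = N
  subst₀ N (suc i) = var i

  _[_]₀ : ∀ {n} → Λ A (suc n) → Λ A n → Λ A n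
  M [ N ]₀ = subst (subst₀ N) M

  infix 4 _=λ_
  data _=λ_ : ∀ {n} → Λ A n → Λ A n → Set where
    β     : ∀ {n} {M : Λ A (suc n)} {N : Λ A n} →
            Affine (app (lam M) N) → app (lam M) N =λ M [ N ]₀
    ξ     : ∀ {n} {M N : Λ A (suc n)} → M =λ N →
            occ zero M ≤ 1 → occ zero N ≤ 1 → lam M =λ lam N
    app-cong : ∀ {n} {M M′ N N′ : Λ A n} → M =λ M′ → N =λ N′ →
               app M N =λ app M′ N′
    refl  : ∀ {n} {M : Λ A n} → Affine M → M =λ M
    sym   : ∀ {n} {M N : Λ A n} → M =λ N → N =λ M
    trans : ∀ {n} {M N P : Λ A n} → M =λ N → N =λ P → M =λ P

  toΛ : CTerm A → Λ A 0
  toΛ `B      = lam (lam (lam (app (var (suc (suc zero)))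
                                   (app (var (suc zero)) (var zero)))))
  toΛ `C      = lam (lam (lam (app (app (var (suc (suc zero))) (var zero))
                                   (var (suc zero)))))
  toΛ `I      = lam (var zero)
  toΛ `K      = lam (lam (var (suc zero)))
  toΛ (c a)   = con a
  toΛ (M · N) = app (toΛ M) (toΛ N)

module _ (𝒜 : SACA) where
  open SACA 𝒜

  IsStrictlyAffineλAlgebra : Set
  IsStrictlyAffineλAlgebra =
    (M N : CTerm Carrier) → toΛ M =λ toΛ N → ⟦ 𝒜 ⟧ M ≈ ⟦ 𝒜 ⟧ N

  IsStrictlyAffineCombλModel : Set
  IsStrictlyAffineCombλModel =
    Σ Carrier λ ε →
      ((x y : Carrier) → ε ∙ x ∙ y ≈ x ∙ y) ×
      ((x y : Carrier) → ((z : Carrier) → x ∙ z ≈ y ∙ z) → ε ∙ x ≈ ε ∙ y)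

module Submission where

-- Terms are interpreted in the relational model of the strictly affine λ-calculus, in which every
-- point of the environment is consumed exactly once.  This interpretation validates =λ, so the
-- combinatory terms over finite sets of points, identified when they denote the same set, form a
-- strictly affine λ-algebra.  The finite sets are restricted to good points (no more negative than
-- positive occurrences of ★), and abstraction and application preserve this balance.  The elements
-- {const★} and {const★, id★} agree on every argument, where id★ = ★ ⊸ ★ and const★ discards its
-- argument; any ε with ε x y = x y contains id★ ⊸ id★, so identifying ε {const★} with
-- ε {const★, id★} would force ε to contain the point const★ ⊸ id★, which is not good.

open import Defs
open import Algebra.Properties.CommutativeSemigroup using (interchange)
open import Data.Empty using (⊥; ⊥-elim)
open import Data.Fin using (Fin; zero; suc; punchIn; _≟_)
open import Data.Fin.Properties using (suc-injective; punchIn-punchOut; punchIn-injective; punchInᵢ≢i)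
open import Data.List using (List; []; _∷_)
open import Data.List.Membership.Propositional using (_∈_)
open import Data.List.Relation.Unary.All as All using (All; []; _∷_)
open import Data.List.Relation.Unary.Any using (here; there)
open import Data.Maybe using (Maybe; just; nothing)
open import Data.Nat using (ℕ; zero; suc; _+_; _≤_; _≤?_; z≤n; s≤s)
open import Data.Nat.Properties
  using (≤-refl; ≤-reflexive; ≤-trans; m≤m+n; m≤n+m; +-assoc; +-comm; +-identityʳ; +-mono-≤; +-cancelʳ-≤;
         m+n≡0⇒m≡0; m+n≡0⇒n≡0; +-commutativeSemigroup; module ≤-Reasoning)
open import Data.Nat.Solver using (module +-*-Solver)
open import Data.Product using (Σ; ∃-syntax; _×_; _,_; proj₁; proj₂; uncurry)
open import Data.Sum as Sum using (_⊎_; inj₁; inj₂)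
open import Data.Vec.Functional using (Vector; head; tail; foldr; insertAt; removeAt)
open import Data.Vec.Functional.Properties using (insertAt-lookup; insertAt-punchIn; insertAt-removeAt)
open import Function using (_∘_)
open import Function.Bundles using (_⇔_; mk⇔; Equivalence)
open import Function.Construct.Composition using (_⇔-∘_)
open import Function.Construct.Identity using (⇔-id)
open import Function.Construct.Symmetry using (⇔-sym)
open import Relation.Binary.PropositionalEquality as ≡ using (_≡_; _≢_; refl; _≗_)
open import Relation.Nullary using (Dec; yes; no; ¬_)
open import Relation.Nullary.Decidable using (True; toWitness; map′; _×-dec_)

open Equivalence using (to; from)

-- Points and environments

-- A point of a function space records the argument point consumed, or nothing when the argument
-- is discarded: a variable of the strictly affine calculus is used at most once.
infixr 5 _⊸_

data Pt : Set where
  ★   : Pt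
  _⊸_ : Maybe Pt → Pt → Pt

pos neg : Pt → ℕ
pos? neg? : Maybe Pt → ℕ

pos ★       = 1
pos (m ⊸ q) = pos q + neg? m

neg ★       = 0
neg (m ⊸ q) = neg q + pos? m

pos? nothing  = 0
pos? (just p) = pos p

neg? nothing  = 0
neg? (just p) = neg p

Good : Pt → Set
Good q = neg q ≤ pos q

Env : ℕ → Set
Env = Vector (Maybe Pt)

∅ : ∀ {n} → Env n
∅ _ = nothing

data Split₁ : Maybe Pt → Maybe Pt → Maybe Pt → Set where
  none  : Split₁ nothing nothing nothing
  left  : ∀ {p} → Split₁ (just p) (just p) nothing
  right : ∀ {p} → Split₁ (just p) nothing (just p)

split₁-idʳ : ∀ x → Split₁ x x nothing
split₁-idʳ nothing  = none
split₁-idʳ (just _) = left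

split₁-idˡ : ∀ x → Split₁ x nothing x
split₁-idˡ nothing  = none
split₁-idˡ (just _) = right

split₁-∅ : ∀ {x a b} → Split₁ x a b → a ≡ nothing → b ≡ nothing → x ≡ nothing
split₁-∅ none refl refl = refl

split₁-∅ʳ : ∀ {x a b} → Split₁ x a b → b ≡ nothing → a ≡ x
split₁-∅ʳ none  _ = refl
split₁-∅ʳ left  _ = refl

split₁-∅ˡ : ∀ {x a b} → Split₁ x a b → a ≡ nothing → b ≡ x
split₁-∅ˡ none  _ = refl
split₁-∅ˡ right _ = refl

split₁-disjoint : ∀ {m₁ m₂} → m₁ ≡ nothing ⊎ m₂ ≡ nothing → ∃[ m ] Split₁ m m₁ m₂
split₁-disjoint {m₂ = m₂} (inj₁ refl) = m₂ , split₁-idˡ m₂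
split₁-disjoint {m₁ = m₁} (inj₂ refl) = m₁ , split₁-idʳ m₁

_∪_ : Maybe Pt → Maybe Pt → Maybe Pt
nothing ∪ y = y
just p  ∪ _ = just p

split₁-interchange : ∀ {x x₁ x₂ a b c d} → Split₁ x x₁ x₂ → Split₁ x₁ a b → Split₁ x₂ c d →
                     Split₁ x (a ∪ c) (b ∪ d) × Split₁ (a ∪ c) a c × Split₁ (b ∪ d) b d
split₁-interchange none  none  none  = none , none , none
split₁-interchange left  left  none  = left , left , none
split₁-interchange left  right none  = right , none , left
split₁-interchange right none  left  = left , right , none
split₁-interchange right none  right = right , none , right

Split : ∀ {n} → Env n → Env n → Env n → Set
Split ρ ρ₁ ρ₂ = ∀ i → Split₁ (ρ i) (ρ₁ i) (ρ₂ i)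

module _ {n : ℕ} where

  split-idʳ : (ρ : Env n) → Split ρ ρ ∅
  split-idʳ ρ i = split₁-idʳ (ρ i)

  split-idˡ : (ρ : Env n) → Split ρ ∅ ρ
  split-idˡ ρ i = split₁-idˡ (ρ i)

  split-∅ : ∀ {ρ ρ₁ ρ₂ : Env n} → Split ρ ρ₁ ρ₂ → ρ₁ ≗ ∅ → ρ₂ ≗ ∅ → ρ ≗ ∅
  split-∅ s e₁ e₂ i = split₁-∅ (s i) (e₁ i) (e₂ i)

  split-∅ʳ : ∀ {ρ ρ₁ ρ₂ : Env n} → Split ρ ρ₁ ρ₂ → ρ₂ ≗ ∅ → ρ₁ ≗ ρ
  split-∅ʳ s e i = split₁-∅ʳ (s i) (e i)

  split-∅ˡ : ∀ {ρ ρ₁ ρ₂ : Env n} → Split ρ ρ₁ ρ₂ → ρ₁ ≗ ∅ → ρ₂ ≗ ρ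
  split-∅ˡ s e i = split₁-∅ˡ (s i) (e i)

  split-≗ : ∀ {ρ ρ′ ρ₁ ρ₂ : Env n} → ρ ≗ ρ′ → Split ρ ρ₁ ρ₂ → Split ρ′ ρ₁ ρ₂
  split-≗ e s i = ≡.subst (λ x → Split₁ x _ _) (e i) (s i)

  split-interchange : ∀ {ρ ρ₁ ρ₂ a b c d : Env n} → Split ρ ρ₁ ρ₂ → Split ρ₁ a b → Split ρ₂ c d →
                      ∃[ e ] ∃[ f ] Split ρ e f × Split e a c × Split f b d
  split-interchange s t u =
    _ , _ , (λ i → proj₁ (I i)) , (λ i → proj₁ (proj₂ (I i))) , (λ i → proj₂ (proj₂ (I i)))
    where I = λ i → split₁-interchange (s i) (t i) (u i)

data PunchView {n} (k : Fin (suc n)) : Fin (suc n) → Set where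
  at      : PunchView k k
  punched : ∀ j → PunchView k (punchIn k j)

punchView : ∀ {n} (k i : Fin (suc n)) → PunchView k i
punchView k i with i ≟ k
... | yes refl = at
... | no i≢k   = ≡.subst (PunchView k) (punchIn-punchOut (i≢k ∘ ≡.sym)) (punched _)

module _ {A : Set} where

  insertAt-map : ∀ {B : Set} {n} (f : A → B) (xs : Vector A n) k v j →
                 f (insertAt xs k v j) ≡ insertAt (f ∘ xs) k (f v) j
  insertAt-map             f xs zero    v zero    = refl
  insertAt-map             f xs zero    v (suc j) = refl
  insertAt-map {n = suc n} f xs (suc k) v zero    = refl
  insertAt-map {n = suc n} f xs (suc k) v (suc j) = insertAt-map f (tail xs) k v j

  insertAt-cong : ∀ {n} {xs ys : Vector A n} k v → xs ≗ ys → insertAt xs k v ≗ insertAt ys k v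
  insertAt-cong         zero    v e zero    = refl
  insertAt-cong         zero    v e (suc j) = e j
  insertAt-cong {suc n} (suc k) v e zero    = e zero
  insertAt-cong {suc n} (suc k) v e (suc j) = insertAt-cong k v (e ∘ suc) j

  insertAt-suc : ∀ {n} (xs : Vector A (suc n)) k v →
                 insertAt xs (suc k) v ≗ insertAt (insertAt (tail xs) k v) zero (head xs)
  insertAt-suc xs k v zero    = refl
  insertAt-suc xs k v (suc j) = refl

insertAt-∅ : ∀ {n} {ρ : Env n} k → ρ ≗ ∅ → insertAt ρ k nothing ≗ ∅
insertAt-∅         zero    e zero    = refl
insertAt-∅         zero    e (suc j) = e j
insertAt-∅ {suc n} (suc k) e zero    = e zero
insertAt-∅ {suc n} (suc k) e (suc j) = insertAt-∅ k (e ∘ suc) j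

insertAt-∅⁻ : ∀ {n} {ρ : Env n} k {x} → insertAt ρ k x ≗ ∅ → x ≡ nothing × ρ ≗ ∅
insertAt-∅⁻ {ρ = ρ} k {x} e =
  ≡.trans (≡.sym (insertAt-lookup ρ k x)) (e k) ,
  λ j → ≡.trans (≡.sym (insertAt-punchIn ρ k x j)) (e (punchIn k j))

split-insertAt : ∀ {n} {ρ ρ₁ ρ₂ : Env n} k {x x₁ x₂} → Split₁ x x₁ x₂ → Split ρ ρ₁ ρ₂ →
                 Split (insertAt ρ k x) (insertAt ρ₁ k x₁) (insertAt ρ₂ k x₂)
split-insertAt         zero    t s zero    = t
split-insertAt         zero    t s (suc j) = s j
split-insertAt {suc n} (suc k) t s zero    = s zero
split-insertAt {suc n} (suc k) t s (suc j) = split-insertAt k t (s ∘ suc) j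

split-insertAt⁻ : ∀ {n} {ρ : Env n} {σ₁ σ₂} k {x} → Split (insertAt ρ k x) σ₁ σ₂ →
                  Split₁ x (σ₁ k) (σ₂ k) × Split ρ (removeAt σ₁ k) (removeAt σ₂ k)
split-insertAt⁻ {ρ = ρ} k {x} s =
  ≡.subst (λ y → Split₁ y _ _) (insertAt-lookup ρ k x) (s k) ,
  λ j → ≡.subst (λ y → Split₁ y _ _) (insertAt-punchIn ρ k x j) (s (punchIn k j))

-- The relational semantics

Rel : ℕ → Set₁
Rel n = Env n → Pt → Set

module _ {n : ℕ} where

  Var : Fin n → Rel n
  Var i ρ q = ρ i ≡ just q × (∀ j → j ≢ i → ρ j ≡ nothing)

  Con : (Pt → Set) → Rel n
  Con P ρ q = ρ ≗ ∅ × P q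

  Arg : Rel n → Env n → Maybe Pt → Set
  Arg F ρ nothing  = ρ ≗ ∅
  Arg F ρ (just p) = F ρ p

  App : Rel n → Rel n → Rel n
  App F G ρ q = ∃[ ρ₁ ] ∃[ ρ₂ ] Split ρ ρ₁ ρ₂ × ∃[ m ] F ρ₁ (m ⊸ q) × Arg G ρ₂ m

Lam : ∀ {n} → Rel (suc n) → Rel n
Lam F ρ ★       = ⊥
Lam F ρ (m ⊸ r) = F (insertAt ρ zero m) r

infix 4 _≃_

_≃_ : ∀ {n} → Rel n → Rel n → Set
F ≃ G = ∀ ρ q → F ρ q ⇔ G ρ q

module _ {n : ℕ} where

  ≃-refl : {F : Rel n} → F ≃ F
  ≃-refl ρ q = ⇔-id _

  ≃-sym : {F G : Rel n} → F ≃ G → G ≃ F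
  ≃-sym e ρ q = ⇔-sym (e ρ q)

  ≃-trans : {F G H : Rel n} → F ≃ G → G ≃ H → F ≃ H
  ≃-trans e e′ ρ q = e′ ρ q ⇔-∘ e ρ q

  Arg-cong : {F G : Rel n} → F ≃ G → ∀ ρ x → Arg F ρ x ⇔ Arg G ρ x
  Arg-cong e ρ nothing  = ⇔-id _
  Arg-cong e ρ (just p) = e ρ p

  App-cong : {F F′ G G′ : Rel n} → F ≃ F′ → G ≃ G′ → App F G ≃ App F′ G′
  App-cong eF eG ρ q = mk⇔
    (λ (ρ₁ , ρ₂ , s , m , f , g) → ρ₁ , ρ₂ , s , m , to (eF ρ₁ (m ⊸ q)) f , to (Arg-cong eG ρ₂ m) g)
    (λ (ρ₁ , ρ₂ , s , m , f , g) → ρ₁ , ρ₂ , s , m , from (eF ρ₁ (m ⊸ q)) f , from (Arg-cong eG ρ₂ m) g)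

  Lam-cong : {F G : Rel (suc n)} → F ≃ G → Lam F ≃ Lam G
  Lam-cong e ρ ★       = ⇔-id _
  Lam-cong e ρ (m ⊸ r) = e (insertAt ρ zero m) r

  Arg-split : ∀ {F : Rel n} {ρ m m₁ m₂} → Split₁ m m₁ m₂ → Arg F ρ m →
              ∃[ ρ₁ ] ∃[ ρ₂ ] Split ρ ρ₁ ρ₂ × Arg F ρ₁ m₁ × Arg F ρ₂ m₂
  Arg-split {ρ = ρ} none  a = ρ , ∅ , split-idʳ ρ , a , λ _ → refl
  Arg-split {ρ = ρ} left  a = ρ , ∅ , split-idʳ ρ , a , λ _ → refl
  Arg-split {ρ = ρ} right a = ∅ , ρ , split-idˡ ρ , (λ _ → refl) , a

Var-at : ∀ {n} {ρ : Env n} k {x q} → Var k (insertAt ρ k x) q ⇔ (x ≡ just q × ρ ≗ ∅)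
Var-at {ρ = ρ} k {x} = mk⇔
  (λ (hit , miss) → ≡.trans (≡.sym (insertAt-lookup ρ k x)) hit ,
     λ j → ≡.trans (≡.sym (insertAt-punchIn ρ k x j)) (miss (punchIn k j) (punchInᵢ≢i k j)))
  (λ { (refl , ρ≗∅) → insertAt-lookup ρ k x , miss ρ≗∅ })
  where
  miss : ρ ≗ ∅ → ∀ j → j ≢ k → insertAt ρ k x j ≡ nothing
  miss ρ≗∅ j j≢k with punchView k j
  ... | at        = ⊥-elim (j≢k refl)
  ... | punched l = ≡.trans (insertAt-punchIn ρ k x l) (ρ≗∅ l)

Var-punchIn : ∀ {n} {ρ : Env n} k {x i q} → Var (punchIn k i) (insertAt ρ k x) q ⇔ (x ≡ nothing × Var i ρ q)
Var-punchIn {ρ = ρ} k {x} {i} = mk⇔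
  (λ (hit , miss) →
     ≡.trans (≡.sym (insertAt-lookup ρ k x)) (miss k (punchInᵢ≢i k i ∘ ≡.sym)) ,
     ≡.trans (≡.sym (insertAt-punchIn ρ k x i)) hit ,
     λ j j≢i → ≡.trans (≡.sym (insertAt-punchIn ρ k x j))
                        (miss (punchIn k j) (j≢i ∘ punchIn-injective k j i)))
  (λ { (refl , hit , miss) → ≡.trans (insertAt-punchIn ρ k x i) hit , miss′ miss })
  where
  miss′ : (∀ j → j ≢ i → ρ j ≡ nothing) → ∀ j → j ≢ punchIn k i → insertAt ρ k nothing j ≡ nothing
  miss′ miss j j≢ki with punchView k j
  ... | at        = insertAt-lookup ρ k nothing
  ... | punched l = ≡.trans (insertAt-punchIn ρ k nothing l) (miss l (j≢ki ∘ ≡.cong (punchIn k)))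

-- Balance

weight : ∀ {n} → (Maybe Pt → ℕ) → Env n → ℕ
weight f = foldr (λ x w → f x + w) 0

module _ (f : Maybe Pt → ℕ) (f-nothing : f nothing ≡ 0) where

  weight-∅ : ∀ {n} {ρ : Env n} → ρ ≗ ∅ → weight f ρ ≡ 0
  weight-∅ {zero}  e = refl
  weight-∅ {suc n} e = ≡.cong₂ _+_ (≡.trans (≡.cong f (e zero)) f-nothing) (weight-∅ (e ∘ suc))

  weight-split : ∀ {n} {ρ ρ₁ ρ₂ : Env n} → Split ρ ρ₁ ρ₂ → weight f ρ ≡ weight f ρ₁ + weight f ρ₂
  weight-split {zero}  s = refl
  weight-split {suc n} {ρ₁ = ρ₁} {ρ₂} s =
    ≡.trans (≡.cong₂ _+_ (additive (s zero)) (weight-split (s ∘ suc)))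
            (interchange +-commutativeSemigroup (f (ρ₁ zero)) (f (ρ₂ zero))
                                                (weight f (tail ρ₁)) (weight f (tail ρ₂)))
    where
    additive : ∀ {x a b} → Split₁ x a b → f x ≡ f a + f b
    additive none  = ≡.sym (≡.cong (_+ f nothing) f-nothing)
    additive left  = ≡.sym (≡.trans (≡.cong (f _ +_) f-nothing) (+-identityʳ _))
    additive right = ≡.sym (≡.cong (_+ f _) f-nothing)

  weight-Var : ∀ {n} {ρ : Env n} {i q} → Var i ρ q → weight f ρ ≡ f (just q)
  weight-Var {i = zero} (hit , miss) =
    ≡.trans (≡.cong₂ _+_ (≡.cong f hit) (weight-∅ (λ j → miss (suc j) λ ()))) (+-identityʳ _)
  weight-Var {i = suc i} (hit , miss) =
    ≡.cong₂ _+_ (≡.trans (≡.cong f (miss zero λ ())) f-nothing)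
                (weight-Var (hit , λ j j≢i → miss (suc j) (j≢i ∘ suc-injective)))

Balanced : ∀ {n} → Env n → Maybe Pt → Set
Balanced ρ x = neg? x + weight pos? ρ ≤ pos? x + weight neg? ρ

balanced-∅ : ∀ {n} {ρ : Env n} x → ρ ≗ ∅ → neg? x ≤ pos? x → Balanced ρ x
balanced-∅ x e g =
  ≡.subst₂ _≤_ (≡.cong (neg? x +_) (≡.sym (weight-∅ pos? refl e)))
               (≡.cong (pos? x +_) (≡.sym (weight-∅ neg? refl e))) (+-mono-≤ g (≤-refl {0}))

balanced-Var : ∀ {n} {ρ : Env n} {i} q → Var i ρ q → Balanced ρ (just q)
balanced-Var q v rewrite weight-Var pos? refl v | weight-Var neg? refl v =
  ≤-reflexive (+-comm (neg q) (pos q))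

balance-cancel : ∀ a b u v x x′ y y′ →
                 a + u + x ≤ b + v + x′ → v + y ≤ u + y′ → a + (x + y) ≤ b + (x′ + y′)
balance-cancel a b u v x x′ y y′ le₁ le₂ = +-cancelʳ-≤ (u + v) _ _ (begin
  a + (x + y) + (u + v)     ≡⟨ solve 5 (λ a u v x y → a :+ (x :+ y) :+ (u :+ v) := a :+ u :+ x :+ (v :+ y))
                                       refl a u v x y ⟩
  a + u + x + (v + y)       ≤⟨ +-mono-≤ le₁ le₂ ⟩
  b + v + x′ + (u + y′)     ≡⟨ solve 5 (λ b u v x′ y′ → b :+ v :+ x′ :+ (u :+ y′) := b :+ (x′ :+ y′) :+ (u :+ v))
                                       refl b u v x′ y′ ⟩
  b + (x′ + y′) + (u + v)   ∎)
  where open ≤-Reasoning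
        open +-*-Solver

balanced-App : ∀ {n} {ρ ρ₁ ρ₂ : Env n} m q → Split ρ ρ₁ ρ₂ →
               Balanced ρ₁ (just (m ⊸ q)) → Balanced ρ₂ m → Balanced ρ (just q)
balanced-App {ρ₁ = ρ₁} {ρ₂} m q s b₁ b₂ rewrite weight-split pos? refl s | weight-split neg? refl s =
  balance-cancel (neg q) (pos q) (pos? m) (neg? m)
                 (weight pos? ρ₁) (weight neg? ρ₁) (weight pos? ρ₂) (weight neg? ρ₂) b₁ b₂

balanced-Lam : ∀ {n} {ρ : Env n} m r → Balanced (insertAt ρ zero m) (just r) → Balanced ρ (just (m ⊸ r))
balanced-Lam {ρ = ρ} m r = ≡.subst₂ _≤_ (≡.sym (+-assoc (neg r) (pos? m) (weight pos? ρ)))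
                                        (≡.sym (+-assoc (pos r) (neg? m) (weight neg? ρ)))

module _ {A : Set} where

  ext-cong : ∀ {m n} {f g : Fin m → Fin n} → f ≗ g → ext {A = A} f ≗ ext {A = A} g
  ext-cong e zero    = refl
  ext-cong e (suc i) = ≡.cong suc (e i)

  rename-cong : ∀ {m n} {f g : Fin m → Fin n} → f ≗ g → (M : Λ A m) → rename f M ≡ rename g M
  rename-cong e (var i)   = ≡.cong var (e i)
  rename-cong e (con a)   = refl
  rename-cong e (app M N) = ≡.cong₂ app (rename-cong e M) (rename-cong e N)
  rename-cong e (lam M)   = ≡.cong lam (rename-cong (ext-cong e) M)

  ext-punchIn : ∀ {n} (k : Fin (suc n)) → ext {A = A} (punchIn k) ≗ punchIn (suc k)
  ext-punchIn k zero    = refl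
  ext-punchIn k (suc i) = refl

  exts-cong : ∀ {m n} {σ τ : Fin m → Λ A n} → σ ≗ τ → exts σ ≗ exts τ
  exts-cong e zero    = refl
  exts-cong e (suc i) = ≡.cong (rename suc) (e i)

  subst-cong : ∀ {m n} {σ τ : Fin m → Λ A n} → σ ≗ τ → (M : Λ A m) → subst σ M ≡ subst τ M
  subst-cong e (var i)   = e i
  subst-cong e (con a)   = refl
  subst-cong e (app M N) = ≡.cong₂ app (subst-cong e M) (subst-cong e N)
  subst-cong e (lam M)   = ≡.cong lam (subst-cong (exts-cong e) M)

  substAt : ∀ {n} → Fin (suc n) → Λ A n → Λ A (suc n) → Λ A n
  substAt k N = subst (insertAt var k N)

  exts-insertAt : ∀ {n} (k : Fin (suc n)) (N : Λ A n) →
                  exts (insertAt var k N) ≗ insertAt var (suc k) (rename suc N)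
  exts-insertAt k N zero    = refl
  exts-insertAt k N (suc j) = insertAt-map (rename suc) var k N j

  subst₀-insertAt : ∀ {n} (N : Λ A n) → subst₀ N ≗ insertAt var zero N
  subst₀-insertAt N zero    = refl
  subst₀-insertAt N (suc i) = refl

m+n≤1⇒m≡0⊎n≡0 : ∀ {m n} → m + n ≤ 1 → m ≡ 0 ⊎ n ≡ 0
m+n≤1⇒m≡0⊎n≡0 {zero}          _             = inj₁ refl
m+n≤1⇒m≡0⊎n≡0 {suc m} {zero}  _             = inj₂ refl
m+n≤1⇒m≡0⊎n≡0 {suc m} {suc n} (s≤s m+1+n≤0) with ≤-trans (m≤n+m (suc n) m) m+1+n≤0
... | ()

-- Interpretation of terms and soundness for =λ

module Semantics {A : Set} (⟦_⟧ᶜ : A → Pt → Set) where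

  sem : ∀ {n} → Λ A n → Rel n
  sem (var i)   = Var i
  sem (con a)   = Con ⟦ a ⟧ᶜ
  sem (app M N) = App (sem M) (sem N)
  sem (lam M)   = Lam (sem M)

  sem? : ∀ {n} → Λ A n → Env n → Maybe Pt → Set
  sem? M = Arg (sem M)

  sem?-≗ : ∀ {n} (M : Λ A n) x {ρ ρ′} → ρ ≗ ρ′ → sem? M ρ x → sem? M ρ′ x
  sem?-≗ M nothing e h i = ≡.trans (≡.sym (e i)) (h i)
  sem?-≗ (var i) (just q) e (hit , miss) =
    ≡.trans (≡.sym (e i)) hit , λ j j≢i → ≡.trans (≡.sym (e j)) (miss j j≢i)
  sem?-≗ (con a) (just q) e (ρ≗∅ , a∋q) = (λ i → ≡.trans (≡.sym (e i)) (ρ≗∅ i)) , a∋q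
  sem?-≗ (app M N) (just q) e (ρ₁ , ρ₂ , s , m , h₁ , h₂) = ρ₁ , ρ₂ , split-≗ e s , m , h₁ , h₂
  sem?-≗ (lam M) (just (m ⊸ r)) e h = sem?-≗ M (just r) (insertAt-cong zero m e) h

  sem?-unused : ∀ {n} (M : Λ A n) i ρ x → occ i M ≡ 0 → sem? M ρ x → ρ i ≡ nothing
  sem?-unused M i ρ nothing _ h = h i
  sem?-unused (var j) i ρ (just q) o (hit , miss) with i ≟ j
  sem?-unused (var j) i ρ (just q) () _ | yes _
  ... | no i≢j = miss i i≢j
  sem?-unused (con a) i ρ (just q) _ (ρ≗∅ , _) = ρ≗∅ i
  sem?-unused (app M N) i ρ (just q) o (ρ₁ , ρ₂ , s , m , h₁ , h₂) =
    split₁-∅ (s i) (sem?-unused M i ρ₁ (just (m ⊸ q)) (m+n≡0⇒m≡0 (occ i M) o) h₁)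
                   (sem?-unused N i ρ₂ m (m+n≡0⇒n≡0 (occ i M) o) h₂)
  sem?-unused (lam M) i ρ (just (m ⊸ r)) o h = sem?-unused M (suc i) (insertAt ρ zero m) (just r) o h

  sem?-unused-insertAt : ∀ {n} (M : Λ A (suc n)) k ρ m x →
                         occ k M ≡ 0 → sem? M (insertAt ρ k m) x → m ≡ nothing
  sem?-unused-insertAt M k ρ m x o h = ≡.trans (≡.sym (insertAt-lookup ρ k m)) (sem?-unused M k _ x o h)

  sem?-weaken : ∀ {n} (N : Λ A n) k ρ x → sem? N ρ x → sem? (rename (punchIn k) N) (insertAt ρ k nothing) x
  sem?-weaken N k ρ nothing h = insertAt-∅ k h
  sem?-weaken (var i) k ρ (just q) h = from (Var-punchIn k) (refl , h)
  sem?-weaken (con a) k ρ (just q) (ρ≗∅ , a∋q) = insertAt-∅ k ρ≗∅ , a∋q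
  sem?-weaken (app M N) k ρ (just q) (ρ₁ , ρ₂ , s , m , h₁ , h₂) =
    insertAt ρ₁ k nothing , insertAt ρ₂ k nothing , split-insertAt k none s , m ,
    sem?-weaken M k ρ₁ (just (m ⊸ q)) h₁ , sem?-weaken N k ρ₂ m h₂
  sem?-weaken (lam M) k ρ (just (m ⊸ r)) h =
    ≡.subst (λ T → sem T (insertAt (insertAt ρ k nothing) zero m) r)
            (≡.sym (rename-cong (ext-punchIn {A = A} k) M))
      (sem?-≗ (rename (punchIn (suc k)) M) (just r) (insertAt-suc (insertAt ρ zero m) k nothing)
        (sem?-weaken M (suc k) (insertAt ρ zero m) (just r) h))

  sem?-strengthen : ∀ {n} (N : Λ A n) k ρ x →
                    sem? (rename (punchIn k) N) ρ x → ρ k ≡ nothing × sem? N (removeAt ρ k) x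
  sem?-strengthen N k ρ nothing h = h k , h ∘ punchIn k
  sem?-strengthen (var i) k ρ (just q) (hit , miss) =
    miss k (punchInᵢ≢i k i ∘ ≡.sym) , hit , λ j j≢i → miss (punchIn k j) (j≢i ∘ punchIn-injective k j i)
  sem?-strengthen (con a) k ρ (just q) (ρ≗∅ , a∋q) = ρ≗∅ k , ρ≗∅ ∘ punchIn k , a∋q
  sem?-strengthen (app M N) k ρ (just q) (ρ₁ , ρ₂ , s , m , h₁ , h₂) =
    let (e₁ , h₁′) = sem?-strengthen M k ρ₁ (just (m ⊸ q)) h₁
        (e₂ , h₂′) = sem?-strengthen N k ρ₂ m h₂
    in split₁-∅ (s k) e₁ e₂ , removeAt ρ₁ k , removeAt ρ₂ k , s ∘ punchIn k , m , h₁′ , h₂′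
  sem?-strengthen (lam M) k ρ (just (m ⊸ r)) h =
    let (e , h′) = sem?-strengthen M (suc k) (insertAt ρ zero m) (just r)
                     (≡.subst (λ T → sem T (insertAt ρ zero m) r) (rename-cong (ext-punchIn {A = A} k) M) h)
    in e , sem?-≗ M (just r) (λ { zero → refl ; (suc j) → refl }) h′

  sem?-merge : ∀ {n} (N : Λ A n) {ρ υ₁ υ₂ m m₁ m₂} → Split₁ m m₁ m₂ → Split ρ υ₁ υ₂ →
               sem? N υ₁ m₁ → sem? N υ₂ m₂ → sem? N ρ m
  sem?-merge N none  s a₁ a₂ = split-∅ s a₁ a₂
  sem?-merge N left  s a₁ a₂ = sem?-≗ N (just _) (split-∅ʳ s a₂) a₁
  sem?-merge N right s a₁ a₂ = sem?-≗ N (just _) (split-∅ˡ s a₁) a₂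

  record Cut {n} (M : Λ A (suc n)) (k : Fin (suc n)) (N : Λ A n) (ρ : Env n) (x : Maybe Pt) : Set where
    constructor cut
    field
      {ρ₁ ρ₂} : Env n
      split   : Split ρ ρ₁ ρ₂
      m       : Maybe Pt
      body    : sem? M (insertAt ρ₁ k m) x
      arg     : sem? N ρ₂ m

  cut-intro : ∀ {n} (M : Λ A (suc n)) k {N ρ} x → Cut M k N ρ x → sem? (substAt k N M) ρ x
  cut-intro M k nothing (cut s m h a) with insertAt-∅⁻ k h
  ... | refl , ρ₁≗∅ = split-∅ s ρ₁≗∅ a
  cut-intro (var i) k {N} (just q) (cut s m h a) with punchView k i
  ... | at with to (Var-at k) h
  ...   | refl , ρ₁≗∅ rewrite insertAt-lookup var k N = sem?-≗ N (just q) (split-∅ˡ s ρ₁≗∅) a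
  cut-intro (var i) k {N} (just q) (cut s m h a) | punched j with to (Var-punchIn k) h
  ...   | refl , h′ rewrite insertAt-punchIn var k N j = sem?-≗ (var j) (just q) (split-∅ʳ s a) h′
  cut-intro (con b) k (just q) (cut s m (h , b∋q) a) with insertAt-∅⁻ k h
  ... | refl , ρ₁≗∅ = split-∅ s ρ₁≗∅ a , b∋q
  cut-intro (app P Q) k (just q) (cut s m (σ₁ , σ₂ , t , m′ , hP , hQ) a) =
    let (t₀ , t′) = split-insertAt⁻ k t
        (υ₁ , υ₂ , u , a₁ , a₂) = Arg-split t₀ a
        (_ , _ , v , v₁ , v₂) = split-interchange s t′ u
    in _ , _ , v , m′ ,
       cut-intro P k (just (m′ ⊸ q)) (cut v₁ (σ₁ k) (sem?-≗ P (just (m′ ⊸ q)) (reinsert σ₁) hP) a₁) ,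
       cut-intro Q k m′ (cut v₂ (σ₂ k) (sem?-≗ Q m′ (reinsert σ₂) hQ) a₂)
    where
    reinsert : ∀ σ → σ ≗ insertAt (removeAt σ k) k (σ k)
    reinsert σ j = ≡.sym (insertAt-removeAt σ k j)
  cut-intro (lam M) k (just ★) (cut _ _ () _)
  cut-intro (lam M) k {N} {ρ} (just (m₀ ⊸ r)) (cut {ρ₁} {ρ₂} s m h a) =
    ≡.subst (λ T → sem T (insertAt ρ zero m₀) r) (≡.sym (subst-cong (exts-insertAt k N) M))
      (cut-intro M (suc k) (just r)
        (cut (split-insertAt zero (split₁-idʳ m₀) s) m
             (sem?-≗ M (just r) (λ j → ≡.sym (insertAt-suc (insertAt ρ₁ zero m₀) k m j)) h)
             (sem?-weaken N zero ρ₂ m a)))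

  cut-nothing : ∀ {n} (M : Λ A (suc n)) k {N ρ} x → sem? M (insertAt ρ k nothing) x → Cut M k N ρ x
  cut-nothing M k {ρ = ρ} x h = cut (split-idʳ ρ) nothing h λ _ → refl

  cut-elim : ∀ {n} (M : Λ A (suc n)) k {N ρ} x → occ k M ≤ 1 → sem? (substAt k N M) ρ x → Cut M k N ρ x
  cut-elim M k nothing _ h = cut-nothing M k nothing (insertAt-∅ k h)
  cut-elim (var i) k {N} {ρ} (just q) _ h with punchView k i
  ... | at rewrite insertAt-lookup var k N =
    cut (split-idˡ ρ) (just q) (from (Var-at k) (refl , λ _ → refl)) h
  ... | punched j rewrite insertAt-punchIn var k N j =
    cut-nothing (var (punchIn k j)) k (just q) (from (Var-punchIn k) (refl , h))
  cut-elim (con b) k (just q) _ (ρ≗∅ , b∋q) = cut-nothing (con b) k (just q) (insertAt-∅ k ρ≗∅ , b∋q)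
  cut-elim (app P Q) k {N} (just q) o (σ₁ , σ₂ , s , m′ , hP , hQ) =
    let cut {τ₁} s₁ m₁ hP′ a₁ = cut-elim P k (just (m′ ⊸ q)) (≤-trans (m≤m+n _ _) o) hP
        cut {τ₂} s₂ m₂ hQ′ a₂ = cut-elim Q k m′ (≤-trans (m≤n+m _ _) o) hQ
        (m , t) = split₁-disjoint (Sum.map (λ e → sem?-unused-insertAt P k τ₁ m₁ (just (m′ ⊸ q)) e hP′)
                                           (λ e → sem?-unused-insertAt Q k τ₂ m₂ m′ e hQ′)
                                           (m+n≤1⇒m≡0⊎n≡0 o))
        (_ , _ , u , u₁ , u₂) = split-interchange s s₁ s₂
    in cut u m (_ , _ , split-insertAt k t u₁ , m′ , hP′ , hQ′) (sem?-merge N t u₂ a₁ a₂)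
  cut-elim (lam M) k (just ★) _ ()
  cut-elim (lam M) k {N} {ρ} (just (m₀ ⊸ r)) o h =
    let h′ = ≡.subst (λ T → sem T (insertAt ρ zero m₀) r) (subst-cong (exts-insertAt k N) M) h
        cut {τ} {υ} s m hM a = cut-elim M (suc k) (just r) o h′
        (υ₀ , a′) = sem?-strengthen N zero υ m a
        (s₀ , s′) = split-insertAt⁻ zero s
        τ₀≡m₀ = split₁-∅ʳ s₀ υ₀
        τ≗ = ≡.subst (λ y → insertAt τ (suc k) m ≗ insertAt (insertAt (tail τ) k m) zero y)
                     τ₀≡m₀ (insertAt-suc τ k m)
    in cut s′ m (sem?-≗ M (just r) τ≗ hM) a′

  β-sound : ∀ {n} {M : Λ A (suc n)} {N : Λ A n} → occ zero M ≤ 1 → sem (app (lam M) N) ≃ sem (M [ N ]₀)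
  β-sound {M = M} {N} o ρ q = mk⇔
    (λ (_ , _ , s , m , h , a) → ≡.subst (λ T → sem T ρ q) substAt≡ (cut-intro M zero (just q) (cut s m h a)))
    (λ h → let cut s m h′ a = cut-elim M zero (just q) o (≡.subst (λ T → sem T ρ q) (≡.sym substAt≡) h)
           in _ , _ , s , m , h′ , a)
    where
    substAt≡ : substAt zero N M ≡ M [ N ]₀
    substAt≡ = ≡.sym (subst-cong (subst₀-insertAt N) M)

  sound : ∀ {n} {M N : Λ A n} → M =λ N → sem M ≃ sem N
  sound (β {M = M} {N} (app (lam _ o) _)) = β-sound {M = M} {N} o
  sound (ξ e _ _)             = Lam-cong (sound e)
  sound (app-cong e e′)       = App-cong (sound e) (sound e′)
  sound (refl _)              = ≃-refl
  sound (sym e)               = ≃-sym (sound e)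
  sound (trans e e′)          = ≃-trans (sound e) (sound e′)

  sem-app₀ : ∀ {M N : Λ A 0} {q} → sem (app M N) ∅ q ⇔ (∃[ m ] sem M ∅ (m ⊸ q) × sem? N ∅ m)
  sem-app₀ {M} {N} {q} = mk⇔
    (λ (_ , _ , _ , m , h , a) → m , sem?-≗ M (just (m ⊸ q)) (λ ()) h , sem?-≗ N m (λ ()) a)
    (λ (m , h , a) → ∅ , ∅ , (λ ()) , m , h , a)

  ≃-closed : ∀ {M N : Λ A 0} → (∀ q → sem M ∅ q ⇔ sem N ∅ q) → sem M ≃ sem N
  ≃-closed {M} {N} e ρ q = mk⇔
    (λ h → sem?-≗ N (just q) (λ ()) (to (e q) (sem?-≗ M (just q) (λ ()) h)))
    (λ h → sem?-≗ M (just q) (λ ()) (from (e q) (sem?-≗ N (just q) (λ ()) h)))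

  module _ (constants-good : ∀ a q → ⟦ a ⟧ᶜ q → Good q) where

    balanced : ∀ {n} (M : Λ A n) ρ x → sem? M ρ x → Balanced ρ x
    balanced M ρ nothing h = balanced-∅ nothing h z≤n
    balanced (var i) ρ (just q) h = balanced-Var q h
    balanced (con a) ρ (just q) (ρ≗∅ , a∋q) = balanced-∅ (just q) ρ≗∅ (constants-good a q a∋q)
    balanced (app M N) ρ (just q) (ρ₁ , ρ₂ , s , m , h₁ , h₂) =
      balanced-App m q s (balanced M ρ₁ (just (m ⊸ q)) h₁) (balanced N ρ₂ m h₂)
    balanced (lam M) ρ (just (m ⊸ r)) h = balanced-Lam {ρ = ρ} m r (balanced M (insertAt ρ zero m) (just r) h)

-- The combinatory axioms in the strictly affine λ-calculus

affine? : ∀ {A : Set} {n} (M : Λ A n) → Dec (Affine M)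
affine? (var i)   = yes (var i)
affine? (con a)   = yes (con a)
affine? (app M N) = map′ (uncurry app) (λ { (app a b) → a , b }) (affine? M ×-dec affine? N)
affine? (lam M)   = map′ (uncurry lam) (λ { (lam a o) → a , o }) (affine? M ×-dec occ zero M ≤? 1)

β! : ∀ {A : Set} {n} {M : Λ A (suc n)} {N : Λ A n} {_ : True (affine? (app (lam M) N))} →
     app (lam M) N =λ M [ N ]₀
β! {_} {_} {_} {_} {a} = β (toWitness a)

module _ {A : Set} where

  I-β : (x : A) → toΛ (`I · c x) =λ toΛ (c x)
  I-β x = β!

  K-β : (x y : A) → toΛ (`K · c x · c y) =λ toΛ (c x)
  K-β x y = trans (app-cong β! (refl (con y))) β!

  B-β : (x y z : A) → toΛ (`B · c x · c y · c z) =λ toΛ (c x · (c y · c z))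
  B-β x y z = trans (app-cong (app-cong β! (refl (con y))) (refl (con z)))
                    (trans (app-cong β! (refl (con z))) β!)

  C-β : (x y z : A) → toΛ (`C · c x · c y · c z) =λ toΛ (c x · c z · c y)
  C-β x y z = trans (app-cong (app-cong β! (refl (con y))) (refl (con z)))
                    (trans (app-cong β! (refl (con z))) β!)

-- The algebra of good points

GoodPoints : Set
GoodPoints = Σ (List Pt) (All Good)

module Points = Semantics {GoodPoints} (λ P q → q ∈ proj₁ P)

Tm : Set
Tm = CTerm GoodPoints

_∋_ : Tm → Pt → Set
t ∋ q = Points.sem (toΛ t) ∅ q

module Elements = Semantics {Tm} _∋_

join : CTerm Tm → Tm
join `B      = `B
join `C      = `C
join `I      = `I
join `K      = `K
join (c t)   = t
join (M · N) = join M · join N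

bridge : ∀ M → Elements.sem (toΛ M) ≃ Points.sem (toΛ (join M))
-- The combinators contain no constants, and Var, App and Lam are defined outside Semantics, so
-- both sides normalise to the same relation.
bridge `B      = ≃-refl
bridge `C      = ≃-refl
bridge `I      = ≃-refl
bridge `K      = ≃-refl
bridge (c t) ρ q = mk⇔ (λ (_ , t∋q) → Points.sem?-≗ (toΛ t) (just q) (λ ()) t∋q)
                       (λ h → (λ ()) , Points.sem?-≗ (toΛ t) (just q) (λ ()) h)
bridge (M · N) = App-cong (bridge M) (bridge N)

infix 4 _≈_

_≈_ : Tm → Tm → Set
t ≈ u = Points.sem (toΛ t) ≃ Points.sem (toΛ u)

combinatory : ∀ M N → toΛ M =λ toΛ N → join M ≈ join N
combinatory M N e = ≃-trans (≃-sym (bridge M)) (≃-trans (Elements.sound e) (bridge N))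

goodPointAlgebra : SACA
goodPointAlgebra = record
  { Carrier       = Tm
  ; _≈_           = _≈_
  ; isEquivalence = record { refl = ≃-refl ; sym = ≃-sym ; trans = ≃-trans }
  ; _∙_           = _·_
  ; ∙-cong        = App-cong
  ; B = `B ; C = `C ; I = `I ; K = `K
  ; B-eq = λ x y z → combinatory (`B · c x · c y · c z) (c x · (c y · c z)) (B-β x y z)
  ; I-eq = λ x → combinatory (`I · c x) (c x) (I-β x)
  ; C-eq = λ x y z → combinatory (`C · c x · c y · c z) (c x · c z · c y) (C-β x y z)
  ; K-eq = λ x y → combinatory (`K · c x · c y) (c x) (K-β x y)
  }

⟦⟧≡join : ∀ M → ⟦ goodPointAlgebra ⟧ M ≡ join M
⟦⟧≡join `B      = refl
⟦⟧≡join `C      = refl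
⟦⟧≡join `I      = refl
⟦⟧≡join `K      = refl
⟦⟧≡join (c t)   = refl
⟦⟧≡join (M · N) = ≡.cong₂ _·_ (⟦⟧≡join M) (⟦⟧≡join N)

goodPointAlgebra-isλAlgebra : IsStrictlyAffineλAlgebra goodPointAlgebra
goodPointAlgebra-isλAlgebra M N e rewrite ⟦⟧≡join M | ⟦⟧≡join N = combinatory M N e

∋-good : ∀ t q → t ∋ q → Good q
∋-good t q h = ≡.subst₂ _≤_ (+-identityʳ (neg q)) (+-identityʳ (pos q))
                 (Points.balanced (λ (_ , good) q q∈ → All.lookup good q∈) (toΛ t) ∅ (just q) h)

∋-· : ∀ {t u q} → (t · u) ∋ q ⇔ (∃[ m ] t ∋ (m ⊸ q) × Points.sem? (toΛ u) ∅ m)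
∋-· {t} {u} {q} = Points.sem-app₀ {toΛ t} {toΛ u} {q}

-- No combinatory λ-model

id★ const★ : Pt
id★    = just ★ ⊸ ★
const★ = nothing ⊸ ★

⟨⟩ ⟨★⟩ ⟨id★⟩ ⟨const★⟩ ⟨const★∣id★⟩ : Tm
⟨⟩           = c ([] , [])
⟨★⟩          = c (★ ∷ [] , z≤n ∷ [])
⟨id★⟩        = c (id★ ∷ [] , s≤s z≤n ∷ [])
⟨const★⟩     = c (const★ ∷ [] , z≤n ∷ [])
⟨const★∣id★⟩ = c (const★ ∷ id★ ∷ [] , z≤n ∷ s≤s z≤n ∷ [])

apply : ∀ t u {p q} → t ∋ (just p ⊸ q) → u ∋ p → (t · u) ∋ q
apply t u {p} h a = from (∋-· {t} {u}) (just p , h , a)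

discard : ∀ t u {q} → t ∋ (nothing ⊸ q) → (t · u) ∋ q
discard t u h = from (∋-· {t} {u}) (nothing , h , λ ())

⟨⟩·-∌ : ∀ u q → ¬ (⟨⟩ · u) ∋ q
⟨⟩·-∌ u q h with to (∋-· {⟨⟩} {u}) h
... | _ , (_ , ()) , _

⟨id★⟩·⟨⟩-∌★ : ¬ (⟨id★⟩ · ⟨⟩) ∋ ★
⟨id★⟩·⟨⟩-∌★ h with to (∋-· {⟨id★⟩} {⟨⟩}) h
... | _ , (_ , here refl) , (_ , ())
... | _ , (_ , there ()) , _

⟨const★⟩-extensional : ∀ z → ⟨const★⟩ · z ≈ ⟨const★∣id★⟩ · z
⟨const★⟩-extensional z =
  Points.≃-closed {toΛ (⟨const★⟩ · z)} {toΛ (⟨const★∣id★⟩ · z)} λ q → mk⇔ (to′ q) (from′ q)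
  where
  to′ : ∀ q → (⟨const★⟩ · z) ∋ q → (⟨const★∣id★⟩ · z) ∋ q
  to′ q h with to (∋-· {⟨const★⟩} {z}) h
  ... | _ , (_ , here refl) , _ = discard ⟨const★∣id★⟩ z ((λ _ → refl) , here refl)
  ... | _ , (_ , there ()) , _
  from′ : ∀ q → (⟨const★∣id★⟩ · z) ∋ q → (⟨const★⟩ · z) ∋ q
  from′ q h with to (∋-· {⟨const★∣id★⟩} {z}) h
  ... | _ , (_ , here refl) , _         = discard ⟨const★⟩ z ((λ _ → refl) , here refl)
  ... | _ , (_ , there (here refl)) , _ = discard ⟨const★⟩ z ((λ _ → refl) , here refl)
  ... | _ , (_ , there (there ())) , _

-- Its negative count is 2, its positive count 1.
const★⊸id★-not-good : ¬ Good (just const★ ⊸ id★)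
const★⊸id★-not-good (s≤s ())

goodPointAlgebra-notModel : ¬ IsStrictlyAffineCombλModel goodPointAlgebra
goodPointAlgebra-notModel (ε , εxy≈xy , ε-ext) = const★⊸id★-not-good (∋-good ε _ ε∋const★⊸id★)
  where
  ε-elim : ∀ x y {q} → (ε · x · y) ∋ q → (x · y) ∋ q
  ε-elim x y {q} = to (εxy≈xy x y ∅ q)

  ε-intro : ∀ x y {q} → (x · y) ∋ q → (ε · x · y) ∋ q
  ε-intro x y {q} = from (εxy≈xy x y ∅ q)

  ε∌discard : ¬ ε ∋ (nothing ⊸ id★)
  ε∌discard h = ⟨⟩·-∌ ⟨★⟩ ★ (ε-elim ⟨⟩ ⟨★⟩ (apply (ε · ⟨⟩) ⟨★⟩ (discard ε ⟨⟩ h) ((λ _ → refl) , here refl)))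

  ε·⟨id★⟩ : (ε · ⟨id★⟩) ∋ id★ → ε ∋ (just id★ ⊸ id★)
  ε·⟨id★⟩ h with to (∋-· {ε} {⟨id★⟩}) h
  ... | nothing , h′ , _              = ⊥-elim (ε∌discard h′)
  ... | just _ , h′ , (_ , here refl) = h′
  ... | just _ , _ , (_ , there ())

  ε∋id★⊸id★ : ε ∋ (just id★ ⊸ id★)
  ε∋id★⊸id★ with to (∋-· {ε · ⟨id★⟩} {⟨★⟩})
                   (ε-intro ⟨id★⟩ ⟨★⟩ (apply ⟨id★⟩ ⟨★⟩ ((λ _ → refl) , here refl) ((λ _ → refl) , here refl)))
  ... | nothing , h , _              = ⊥-elim (⟨id★⟩·⟨⟩-∌★ (ε-elim ⟨id★⟩ ⟨⟩ (discard (ε · ⟨id★⟩) ⟨⟩ h)))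
  ... | just _ , h , (_ , here refl) = ε·⟨id★⟩ h
  ... | just _ , _ , (_ , there ())

  ε∋const★⊸id★ : ε ∋ (just const★ ⊸ id★)
  ε∋const★⊸id★ with to (∋-· {ε} {⟨const★⟩})
                      (from (ε-ext ⟨const★⟩ ⟨const★∣id★⟩ ⟨const★⟩-extensional ∅ id★)
                            (apply ε ⟨const★∣id★⟩ ε∋id★⊸id★ ((λ _ → refl) , there (here refl))))
  ... | nothing , h , _              = ⊥-elim (ε∌discard h)
  ... | just _ , h , (_ , here refl) = h
  ... | just _ , _ , (_ , there ())

mainTheorem4 : Σ SACA λ 𝒜 → IsStrictlyAffineλAlgebra 𝒜 × ¬ IsStrictlyAffineCombλModel 𝒜
mainTheorem4 = goodPointAlgebra , goodPointAlgebra-isλAlgebra , goodPointAlgebra-notModel
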